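{- For every integer $n \ge 2$, $$i_S(n) = \frac{3n}{16} + \frac{33}{64} + \frac{7\psi(n-2) + 5\psi(n-1)}{2^{n+4}}$$ and $$a_S(n) = \frac{3n}{16} + \frac{9}{64} - \frac{\psi(n-2) + 3\psi(n-1)}{2^{n+4}}.$$
   Context: Seating process: seats and napkins alternate; diners are seated one at a time in empty seats chosen by the maître d' (who observes all napkin choices); each diner takes an available adjacent napkin (uniformly at random independently if both adjacent napkins are available, the unique one if exactly one is, none otherwise, in which case the diner is napkinless). An empty seat and an available napkin are neighbors if they are adjacent. The long trap setting strategy $S$: (S1) if some available napkin neighbors exactly one empty seat, seat the next diner in that empty seat; (S2) otherwise, if there is an empty seat $X$ three seats away from an occupied seat with the two seats strictly between them both empty, seat the next diner in such an $X$; if there is no such seat, seat the next diner in any empty seat. For $n \ge 1$, consider a row of $n$ consecutive empty seats $s_1,\dots,s_n$ with an available napkin between $s_j$ and $s_{j+1}$ for each $j$, flanked on both sides by occupied seats (such a row arises as a maximal run of empty seats on a circular table during play); the boundary napkin between $s_1$ and the left occupied seat, and the one between $s_n$ and the right occupied seat, are each either available or already taken. The row is inner-facing if both boundary napkins are taken, outer-facing if both are available, and asymmetric if exactly one is available. Let $i_S(n)$, $o_S(n)$, $a_S(n)$ denote the expected number of diners seated in $s_1,\dots,s_n$ who receive no napkin when these seats are filled according to $S$, for an inner-facing, outer-facing, respectively asymmetric row of length $n$ (this value does not depend on the surroundings of the row or on tie-breaking in $S$). The sequence $\psi$ is defined by $\psi(0)=1$, $\psi(1)=0$, $\psi(n)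 = -2\psi(n-2) - \psi(n-1)$ for $n\ge 2$. -}

module Defs where

open import Data.Bool using (Bool; true; false; _xor_)
open import Data.Nat as ℕ using (ℕ; zero; suc; _∸_; _^_; _≤_)
open import Data.Nat.Properties using (m^n≢0)
open import Data.Integer as ℤ using (ℤ; +_; -_)
open import Data.Rational as ℚ using (ℚ; 0ℚ; 1ℚ; ½)
open import Data.List using (List; []; _∷_; _++_; replicate)
open import Data.List.Relation.Unary.All using (All)
open import Data.Maybe using (Maybe; just; nothing)
open import Data.Product using (Σ; _×_; _,_)
open import Data.Sum using (_⊎_)
open import Relation.Nullary using (¬_)
open import Relation.Binary.PropositionalEquality using (_≡_)

ψ : ℕ → ℤ
ψ zero = + 1
ψ (suc zero) = + 0
ψ (suc (suc n)) = (- ((+ 2) ℤ.* ψ n)) ℤ.- ψ (suc n)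

_‼_ : List Bool → ℕ → Maybe Bool
[] ‼ _ = nothing
(x ∷ xs) ‼ zero = just x
(x ∷ xs) ‼ suc i = xs ‼ i

set : List Bool → ℕ → Bool → List Bool
set [] _ _ = []
set (x ∷ xs) zero b = b ∷ xs
set (x ∷ xs) (suc i) b = x ∷ set xs i b

-- A row of seats s_1..s_n flanked by occupied seats.
--   seats : s_1 .. s_n       (true = occupied)
--   naps  : N_0 .. N_n       (true = available); N_k lies between
--           extended positions k and k+1, where extended position 0 is the
--           left occupied flank, position j (1≤j≤n) is s_j, and position
--           n+1 is the right occupied flank.

record Row : Set where
  constructor row
  field
    seats : List Bool
    naps  : List Bool
open Row public

ext : Row → List Bool
ext r = true ∷ (seats r ++ true ∷ [])

Occ Emp Avail Taken : Row → ℕ → Set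
Occ   r p = ext r ‼ p ≡ just true
Emp   r p = ext r ‼ p ≡ just false
Avail r k = naps r ‼ k ≡ just true
Taken r k = naps r ‼ k ≡ just false

S1Seat : Row → ℕ → Set
S1Seat r p = Emp r p × Σ ℕ λ k → Avail r k ×
  ((p ≡ k × Occ r (suc k)) ⊎ (p ≡ suc k × Occ r k))

S2Seat : Row → ℕ → Set
S2Seat r p = Emp r p × Σ ℕ λ q → Occ r q ×
  ((q ℕ.+ 3 ≡ p × Emp r (q ℕ.+ 1) × Emp r (q ℕ.+ 2)) ⊎
   (p ℕ.+ 3 ≡ q × Emp r (p ℕ.+ 1) × Emp r (p ℕ.+ 2)))

Allowed : Row → ℕ → Set
Allowed r p =
  S1Seat r p ⊎
  ((¬ Σ ℕ (S1Seat r) × S2Seat r p) ⊎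
   (¬ Σ ℕ (S1Seat r) × ¬ Σ ℕ (S2Seat r) × Emp r p))

seatTake : Row → ℕ → ℕ → Row
seatTake r p k = row (set (seats r) (p ∸ 1) true) (set (naps r) k false)

seatNone : Row → ℕ → Row
seatNone r p = row (set (seats r) (p ∸ 1) true) (naps r)

-- Val r v : v is the expected number of napkinless diners when the empty
-- seats of r are filled according to S, for some (possibly history
-- dependent) tie-breaking.  The diner at position p has left napkin p-1
-- and right napkin p.
data Val : Row → ℚ → Set where
  done  : ∀ {r} → All (_≡ true) (seats r) → Val r 0ℚ
  both  : ∀ {r p v w} → Allowed r p → Avail r (p ∸ 1) → Avail r p →
          Val (seatTake r p (p ∸ 1)) v → Val (seatTake r p p) w →
          Val r (½ ℚ.* v ℚ.+ ½ ℚ.* w)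
  left  : ∀ {r p v} → Allowed r p → Avail r (p ∸ 1) → Taken r p →
          Val (seatTake r p (p ∸ 1)) v → Val r v
  right : ∀ {r p v} → Allowed r p → Taken r (p ∸ 1) → Avail r p →
          Val (seatTake r p p) v → Val r v
  none  : ∀ {r p v} → Allowed r p → Taken r (p ∸ 1) → Taken r p →
          Val (seatNone r p) v → Val r (1ℚ ℚ.+ v)

ExpectedNapkinless : Row → ℚ → Set
ExpectedNapkinless r q = Val r q × (∀ v → Val r v → v ≡ q)

initRow : ℕ → Bool → Bool → Row
initRow n l b = row (replicate n false) (l ∷ (replicate (n ∸ 1) true ++ b ∷ []))

_/2^_ : ℤ → ℕ → ℚ
z /2^ m = ℚ._/_ z (2 ^ m) {{m^n≢0 2 m}}

iFormula : ℕ → ℚ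
iFormula n = (+ (3 ℕ.* n)) ℚ./ 16 ℚ.+ (+ 33) ℚ./ 64 ℚ.+
  (((+ 7) ℤ.* ψ (n ∸ 2) ℤ.+ (+ 5) ℤ.* ψ (n ∸ 1)) /2^ (n ℕ.+ 4))

aFormula : ℕ → ℚ
aFormula n = (+ (3 ℕ.* n)) ℚ./ 16 ℚ.+ (+ 9) ℚ./ 64 ℚ.-
  ((ψ (n ∸ 2) ℤ.+ (+ 3) ℤ.* ψ (n ∸ 1)) /2^ (n ℕ.+ 4))

module Submission where

-- Under S the maximal runs of empty seats evolve independently: whichever run S seats the
-- next diner in, the seats it may choose there and the napkins that diner finds depend only on
-- the length of the run and on which of its two boundary napkins are still available.  So the
-- sum over the runs of a value determined by these data satisfies the one-step equation that
-- defines Val, the runs left alone contributing the same before and after the step; by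
-- induction on the number of empty seats it is therefore the one value Val admits, whatever
-- the tie-breaking.  The closed forms for i_S and a_S are then checked against the run
-- recurrences: written as polynomials in n, ψ (n - 2), ψ (n - 1) and 2⁻ⁿ, each step of the
-- recurrences is a ring identity.

open import Defs
open import Data.Bool as Bool using (Bool; true; false; _xor_)
open import Data.Bool.Properties using (¬-not)
open import Data.Empty using (⊥-elim)
open import Data.Integer as ℤ using (ℤ; +_)
import Data.Integer.Properties as ℤ
import Data.Integer.Solver as ℤ-Solver
open import Data.List using (List; []; _∷_; _++_; _∷ʳ_; replicate; length)
import Data.List.Properties as List
open import Data.List.Relation.Unary.All using (All; []; _∷_)
open import Data.Maybe using (Maybe; just)
open import Data.Maybe.Properties as Maybe using (just-injective)
open import Data.Nat as ℕ using (ℕ; zero; suc; _+_; _∸_; _≤_; _<_; z≤n; s≤s)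
import Data.Nat.Properties as ℕ
open import Data.Nat.Tactic.RingSolver using (solve-∀)
open import Data.Product using (Σ; _×_; _,_; proj₁; proj₂)
open import Data.Rational as ℚ using (ℚ; 0ℚ; 1ℚ; ½; toℚᵘ)
import Data.Rational.Properties as ℚ
import Data.Rational.Solver as ℚ-Solver
import Data.Rational.Unnormalised as ℚᵘ
import Data.Rational.Unnormalised.Properties as ℚᵘ
open import Data.Sum using (_⊎_; inj₁; inj₂)
open import Function using (_∘_)
open import Relation.Binary.Definitions using (DecidableEquality)
open import Relation.Binary.PropositionalEquality
open import Relation.Nullary using (¬_; Dec; yes; no)
open import Relation.Nullary.Decidable using (_×-dec_; _⊎-dec_; map′)
open import Relation.Unary using (Decidable)

-- S seats the first diner of an asymmetric or
-- outer run next to an available boundary napkin, and that of an inner run of length ≥ 4 three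
-- seats from one of its ends; an inner run of length 1, 2 or 3 leaves exactly one diner napkinless.
mutual
  asymmetric : ℕ → ℚ
  asymmetric zero    = 0ℚ
  asymmetric (suc n) = ½ ℚ.* asymmetric n ℚ.+ ½ ℚ.* inner n

  inner : ℕ → ℚ
  inner 0 = 0ℚ
  inner 1 = 1ℚ
  inner 2 = 1ℚ
  inner 3 = 1ℚ
  inner (suc (suc (suc (suc n)))) =
    ½ ℚ.* (inner 2 ℚ.+ asymmetric (suc n)) ℚ.+ ½ ℚ.* (asymmetric 2 ℚ.+ inner (suc n))

outer : ℕ → ℚ
outer zero    = 0ℚ
outer (suc n) = ½ ℚ.* outer n ℚ.+ ½ ℚ.* asymmetric n

fromℤ : ℤ → ℚ
fromℤ z = z ℚ./ 1

toℚᵘ-fromℤ : ∀ z → toℚᵘ (fromℤ z) ℚᵘ.≃ ℚᵘ.mkℚᵘ z 0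
toℚᵘ-fromℤ z = ℚ.toℚᵘ-fromℚᵘ (ℚᵘ.mkℚᵘ z 0)

fromℤ-homo-+ : ∀ x y → fromℤ (x ℤ.+ y) ≡ fromℤ x ℚ.+ fromℤ y
fromℤ-homo-+ x y = ℚ.toℚᵘ-injective (begin
  toℚᵘ (fromℤ (x ℤ.+ y))               ≈⟨ toℚᵘ-fromℤ (x ℤ.+ y) ⟩
  ℚᵘ.mkℚᵘ (x ℤ.+ y) 0                  ≈⟨ ℚᵘ.*≡* (solve 2 (λ x y → (x :+ y) :* con (+ 1) := (x :* con (+ 1) :+ y :* con (+ 1)) :* con (+ 1)) refl x y) ⟩
  ℚᵘ.mkℚᵘ x 0 ℚᵘ.+ ℚᵘ.mkℚᵘ y 0         ≈⟨ ℚᵘ.+-cong (toℚᵘ-fromℤ x) (toℚᵘ-fromℤ y) ⟨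
  toℚᵘ (fromℤ x) ℚᵘ.+ toℚᵘ (fromℤ y)   ≈⟨ ℚ.toℚᵘ-homo-+ (fromℤ x) (fromℤ y) ⟨
  toℚᵘ (fromℤ x ℚ.+ fromℤ y)           ∎)
  where open ℚᵘ.≃-Reasoning; open ℤ-Solver.+-*-Solver

fromℤ-homo-* : ∀ x y → fromℤ (x ℤ.* y) ≡ fromℤ x ℚ.* fromℤ y
fromℤ-homo-* x y = ℚ.toℚᵘ-injective (begin
  toℚᵘ (fromℤ (x ℤ.* y))               ≈⟨ toℚᵘ-fromℤ (x ℤ.* y) ⟩
  ℚᵘ.mkℚᵘ x 0 ℚᵘ.* ℚᵘ.mkℚᵘ y 0         ≈⟨ ℚᵘ.*-cong (toℚᵘ-fromℤ x) (toℚᵘ-fromℤ y) ⟨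
  toℚᵘ (fromℤ x) ℚᵘ.* toℚᵘ (fromℤ y)   ≈⟨ ℚ.toℚᵘ-homo-* (fromℤ x) (fromℤ y) ⟨
  toℚᵘ (fromℤ x ℚ.* fromℤ y)           ∎)
  where open ℚᵘ.≃-Reasoning

fromℤ-homo‿- : ∀ x → fromℤ (ℤ.- x) ≡ ℚ.- fromℤ x
fromℤ-homo‿- x = ℚ.toℚᵘ-injective (begin
  toℚᵘ (fromℤ (ℤ.- x))   ≈⟨ toℚᵘ-fromℤ (ℤ.- x) ⟩
  ℚᵘ.- ℚᵘ.mkℚᵘ x 0       ≈⟨ ℚᵘ.-‿cong (toℚᵘ-fromℤ x) ⟨
  ℚᵘ.- toℚᵘ (fromℤ x)    ≈⟨ ℚ.toℚᵘ-homo‿- (fromℤ x) ⟨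
  toℚᵘ (ℚ.- fromℤ x)     ∎)
  where open ℚᵘ.≃-Reasoning

fromℤ-suc : ∀ n → fromℤ (+ suc n) ≡ 1ℚ ℚ.+ fromℤ (+ n)
fromℤ-suc n = fromℤ-homo-+ (+ 1) (+ n)

½^_ : ℕ → ℚ
½^ zero  = 1ℚ
½^ suc m = ½ ℚ.* ½^ m

½^-+ : ∀ m n → ½^ (m + n) ≡ ½^ m ℚ.* ½^ n
½^-+ zero    n = sym (ℚ.*-identityˡ (½^ n))
½^-+ (suc m) n = trans (cong (½ ℚ.*_) (½^-+ m n)) (sym (ℚ.*-assoc ½ (½^ m) (½^ n)))

/-2* : ∀ z d .{{_ : ℕ.NonZero d}} .{{_ : ℕ.NonZero (2 ℕ.* d)}} → z ℚ./ (2 ℕ.* d) ≡ ½ ℚ.* (z ℚ./ d)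
/-2* z (suc d) = ℚ.toℚᵘ-injective (begin
  toℚᵘ (z ℚ./ (2 ℕ.* suc d))        ≈⟨ ℚ.toℚᵘ-fromℚᵘ (ℚᵘ.mkℚᵘ z (d + suc (d + 0))) ⟩
  ℚᵘ.mkℚᵘ z (d + suc (d + 0))       ≈⟨ ℚᵘ.*≡* (cong (ℤ._* (+ suc (d + suc (d + 0)))) (ℤ.*-identityˡ z)) ⟨
  toℚᵘ ½ ℚᵘ.* ℚᵘ.mkℚᵘ z d           ≈⟨ ℚᵘ.*-congˡ {toℚᵘ ½} (ℚ.toℚᵘ-fromℚᵘ (ℚᵘ.mkℚᵘ z d)) ⟨
  toℚᵘ ½ ℚᵘ.* toℚᵘ (z ℚ./ suc d)    ≈⟨ ℚ.toℚᵘ-homo-* ½ (z ℚ./ suc d) ⟨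
  toℚᵘ (½ ℚ.* (z ℚ./ suc d))        ∎)
  where open ℚᵘ.≃-Reasoning

/2^≡*½^ : ∀ z m → z /2^ m ≡ fromℤ z ℚ.* ½^ m
/2^≡*½^ z zero    = sym (ℚ.*-identityʳ (fromℤ z))
/2^≡*½^ z (suc m) = begin
  z /2^ suc m                 ≡⟨ /-2* z (2 ℕ.^ m) {{ℕ.m^n≢0 2 m}} {{ℕ.m^n≢0 2 (suc m)}} ⟩
  ½ ℚ.* (z /2^ m)             ≡⟨ cong (½ ℚ.*_) (/2^≡*½^ z m) ⟩
  ½ ℚ.* (fromℤ z ℚ.* ½^ m)    ≡⟨ solve 3 (λ a b c → a :* (b :* c) := b :* (a :* c)) refl ½ (fromℤ z) (½^ m) ⟩
  fromℤ z ℚ.* (½ ℚ.* ½^ m)    ∎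
  where open ≡-Reasoning; open ℚ-Solver.+-*-Solver

Ψ : ℕ → ℚ
Ψ k = fromℤ (ψ k)

next : ℚ → ℚ → ℚ
next x y = ℚ.- (fromℤ (+ 2) ℚ.* x) ℚ.+ ℚ.- y

Ψ-rec : ∀ k → Ψ (suc (suc k)) ≡ next (Ψ k) (Ψ (suc k))
Ψ-rec k = begin
  fromℤ (ℤ.- (+ 2 ℤ.* ψ k) ℤ.+ ℤ.- ψ (suc k))          ≡⟨ fromℤ-homo-+ (ℤ.- (+ 2 ℤ.* ψ k)) (ℤ.- ψ (suc k)) ⟩
  fromℤ (ℤ.- (+ 2 ℤ.* ψ k)) ℚ.+ fromℤ (ℤ.- ψ (suc k))  ≡⟨ cong₂ ℚ._+_ (fromℤ-homo‿- (+ 2 ℤ.* ψ k)) (fromℤ-homo‿- (ψ (suc k))) ⟩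
  ℚ.- fromℤ (+ 2 ℤ.* ψ k) ℚ.+ ℚ.- Ψ (suc k)            ≡⟨ cong (λ t → ℚ.- t ℚ.+ ℚ.- Ψ (suc k)) (fromℤ-homo-* (+ 2) (ψ k)) ⟩
  next (Ψ k) (Ψ (suc k))                               ∎
  where open ≡-Reasoning

-- iFormula (2 + k) and aFormula (2 + k) as polynomials in k, ψ k, ψ (1 + k) and 2⁻ᵏ.
iShape aShape : ℚ → ℚ → ℚ → ℚ → ℚ
iShape k x y h = fromℤ (+ 3) ℚ.* (k ℚ.+ fromℤ (+ 2)) ℚ.* ½^ 4 ℚ.+ (+ 33) ℚ./ 64
  ℚ.+ (fromℤ (+ 7) ℚ.* x ℚ.+ fromℤ (+ 5) ℚ.* y) ℚ.* (½ ℚ.* (½ ℚ.* (h ℚ.* ½^ 4)))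
aShape k x y h = fromℤ (+ 3) ℚ.* (k ℚ.+ fromℤ (+ 2)) ℚ.* ½^ 4 ℚ.+ (+ 9) ℚ./ 64
  ℚ.- (x ℚ.+ fromℤ (+ 3) ℚ.* y) ℚ.* (½ ℚ.* (½ ℚ.* (h ℚ.* ½^ 4)))

module _ where
  open ℚ-Solver.+-*-Solver

  private
    iShapeP aShapeP : ∀ {n} → Polynomial n → Polynomial n → Polynomial n → Polynomial n → Polynomial n
    iShapeP k x y h = con (fromℤ (+ 3)) :* (k :+ con (fromℤ (+ 2))) :* con (½^ 4) :+ con ((+ 33) ℚ./ 64)
      :+ (con (fromℤ (+ 7)) :* x :+ con (fromℤ (+ 5)) :* y) :* (con ½ :* (con ½ :* (h :* con (½^ 4))))
    aShapeP k x y h = con (fromℤ (+ 3)) :* (k :+ con (fromℤ (+ 2))) :* con (½^ 4) :+ con ((+ 9) ℚ./ 64)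
      :- (x :+ con (fromℤ (+ 3)) :* y) :* (con ½ :* (con ½ :* (h :* con (½^ 4))))

    nextP : ∀ {n} → Polynomial n → Polynomial n → Polynomial n
    nextP x y = :- (con (fromℤ (+ 2)) :* x) :+ :- y

    1+P : ∀ {n} → Polynomial n → Polynomial n
    1+P k = con 1ℚ :+ k

  iShape-step : ∀ k x y h →
    iShape (1ℚ ℚ.+ (1ℚ ℚ.+ (1ℚ ℚ.+ k))) (next y (next x y)) (next (next x y) (next y (next x y))) (½ ℚ.* (½ ℚ.* (½ ℚ.* h)))
      ≡ ½ ℚ.* (1ℚ ℚ.+ aShape k x y h) ℚ.+ ½ ℚ.* (asymmetric 2 ℚ.+ iShape k x y h)
  iShape-step = solve 4 (λ k x y h →
    iShapeP (1+P (1+P (1+P k))) (nextP y (nextP x y)) (nextP (nextP x y) (nextP y (nextP x y))) (con ½ :* (con ½ :* (con ½ :* h)))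
      := con ½ :* (con 1ℚ :+ aShapeP k x y h) :+ con ½ :* (con (asymmetric 2) :+ iShapeP k x y h)) refl

  aShape-step : ∀ k x y h →
    aShape (1ℚ ℚ.+ k) y (next x y) (½ ℚ.* h) ≡ ½ ℚ.* aShape k x y h ℚ.+ ½ ℚ.* iShape k x y h
  aShape-step = solve 4 (λ k x y h →
    aShapeP (1+P k) y (nextP x y) (con ½ :* h) := con ½ :* aShapeP k x y h :+ con ½ :* iShapeP k x y h) refl

linear-shape : ∀ k → (+ (3 ℕ.* suc (suc k))) ℚ./ 16 ≡ fromℤ (+ 3) ℚ.* (fromℤ (+ k) ℚ.+ fromℤ (+ 2)) ℚ.* ½^ 4
linear-shape k = begin
  (+ (3 ℕ.* suc (suc k))) /2^ 4                        ≡⟨ /2^≡*½^ (+ (3 ℕ.* suc (suc k))) 4 ⟩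
  fromℤ (+ (3 ℕ.* suc (suc k))) ℚ.* ½^ 4               ≡⟨ cong (λ t → fromℤ t ℚ.* ½^ 4) (ℤ.pos-* 3 (suc (suc k))) ⟩
  fromℤ (+ 3 ℤ.* + suc (suc k)) ℚ.* ½^ 4               ≡⟨ cong (ℚ._* ½^ 4) (fromℤ-homo-* (+ 3) (+ suc (suc k))) ⟩
  fromℤ (+ 3) ℚ.* fromℤ (+ suc (suc k)) ℚ.* ½^ 4       ≡⟨ cong (λ t → fromℤ (+ 3) ℚ.* fromℤ t ℚ.* ½^ 4) (trans (cong +_ (ℕ.+-comm 2 k)) (ℤ.pos-+ k 2)) ⟩
  fromℤ (+ 3) ℚ.* fromℤ (+ k ℤ.+ + 2) ℚ.* ½^ 4         ≡⟨ cong (λ t → fromℤ (+ 3) ℚ.* t ℚ.* ½^ 4) (fromℤ-homo-+ (+ k) (+ 2)) ⟩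
  fromℤ (+ 3) ℚ.* (fromℤ (+ k) ℚ.+ fromℤ (+ 2)) ℚ.* ½^ 4  ∎
  where open ≡-Reasoning

iFormula-shape : ∀ k → iFormula (suc (suc k)) ≡ iShape (fromℤ (+ k)) (Ψ k) (Ψ (suc k)) (½^ k)
iFormula-shape k = cong₂ ℚ._+_ (cong (ℚ._+ (+ 33) ℚ./ 64) (linear-shape k)) (begin
  ((+ 7) ℤ.* ψ k ℤ.+ (+ 5) ℤ.* ψ (suc k)) /2^ (suc (suc k) + 4)
    ≡⟨ /2^≡*½^ ((+ 7) ℤ.* ψ k ℤ.+ (+ 5) ℤ.* ψ (suc k)) (suc (suc k) + 4) ⟩
  fromℤ ((+ 7) ℤ.* ψ k ℤ.+ (+ 5) ℤ.* ψ (suc k)) ℚ.* (½ ℚ.* (½ ℚ.* ½^ (k + 4)))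
    ≡⟨ cong₂ ℚ._*_ (fromℤ-homo-+ ((+ 7) ℤ.* ψ k) ((+ 5) ℤ.* ψ (suc k))) (cong (λ t → ½ ℚ.* (½ ℚ.* t)) (½^-+ k 4)) ⟩
  (fromℤ ((+ 7) ℤ.* ψ k) ℚ.+ fromℤ ((+ 5) ℤ.* ψ (suc k))) ℚ.* (½ ℚ.* (½ ℚ.* (½^ k ℚ.* ½^ 4)))
    ≡⟨ cong (ℚ._* (½ ℚ.* (½ ℚ.* (½^ k ℚ.* ½^ 4)))) (cong₂ ℚ._+_ (fromℤ-homo-* (+ 7) (ψ k)) (fromℤ-homo-* (+ 5) (ψ (suc k)))) ⟩
  (fromℤ (+ 7) ℚ.* Ψ k ℚ.+ fromℤ (+ 5) ℚ.* Ψ (suc k)) ℚ.* (½ ℚ.* (½ ℚ.* (½^ k ℚ.* ½^ 4)))  ∎)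
  where open ≡-Reasoning

aFormula-shape : ∀ k → aFormula (suc (suc k)) ≡ aShape (fromℤ (+ k)) (Ψ k) (Ψ (suc k)) (½^ k)
aFormula-shape k = cong₂ ℚ._-_ (cong (ℚ._+ (+ 9) ℚ./ 64) (linear-shape k)) (begin
  (ψ k ℤ.+ (+ 3) ℤ.* ψ (suc k)) /2^ (suc (suc k) + 4)
    ≡⟨ /2^≡*½^ (ψ k ℤ.+ (+ 3) ℤ.* ψ (suc k)) (suc (suc k) + 4) ⟩
  fromℤ (ψ k ℤ.+ (+ 3) ℤ.* ψ (suc k)) ℚ.* (½ ℚ.* (½ ℚ.* ½^ (k + 4)))
    ≡⟨ cong₂ ℚ._*_ (fromℤ-homo-+ (ψ k) ((+ 3) ℤ.* ψ (suc k))) (cong (λ t → ½ ℚ.* (½ ℚ.* t)) (½^-+ k 4)) ⟩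
  (Ψ k ℚ.+ fromℤ ((+ 3) ℤ.* ψ (suc k))) ℚ.* (½ ℚ.* (½ ℚ.* (½^ k ℚ.* ½^ 4)))
    ≡⟨ cong (λ t → (Ψ k ℚ.+ t) ℚ.* (½ ℚ.* (½ ℚ.* (½^ k ℚ.* ½^ 4)))) (fromℤ-homo-* (+ 3) (ψ (suc k))) ⟩
  (Ψ k ℚ.+ fromℤ (+ 3) ℚ.* Ψ (suc k)) ℚ.* (½ ℚ.* (½ ℚ.* (½^ k ℚ.* ½^ 4)))  ∎)
  where open ≡-Reasoning

iFormula-step : ∀ k → iFormula (5 + k) ≡ ½ ℚ.* (1ℚ ℚ.+ aFormula (2 + k)) ℚ.+ ½ ℚ.* (asymmetric 2 ℚ.+ iFormula (2 + k))
iFormula-step k = begin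
  iFormula (5 + k)
    ≡⟨ iFormula-shape (3 + k) ⟩
  iShape (fromℤ (+ (3 + k))) (Ψ (3 + k)) (Ψ (4 + k)) (½^ (3 + k))
    ≡⟨ cong (λ s → iShape s (Ψ (3 + k)) (Ψ (4 + k)) (½^ (3 + k))) K₃ ⟩
  iShape (1ℚ ℚ.+ (1ℚ ℚ.+ (1ℚ ℚ.+ K))) (Ψ (3 + k)) (Ψ (4 + k)) (½^ (3 + k))
    ≡⟨ cong₂ (λ s t → iShape (1ℚ ℚ.+ (1ℚ ℚ.+ (1ℚ ℚ.+ K))) s t (½^ (3 + k))) X₃ Y₃ ⟩
  iShape (1ℚ ℚ.+ (1ℚ ℚ.+ (1ℚ ℚ.+ K))) (next Y (next X Y)) (next (next X Y) (next Y (next X Y))) (½ ℚ.* (½ ℚ.* (½ ℚ.* ½^ k)))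
    ≡⟨ iShape-step K X Y (½^ k) ⟩
  ½ ℚ.* (1ℚ ℚ.+ aShape K X Y (½^ k)) ℚ.+ ½ ℚ.* (asymmetric 2 ℚ.+ iShape K X Y (½^ k))
    ≡⟨ cong₂ (λ s t → ½ ℚ.* (1ℚ ℚ.+ s) ℚ.+ ½ ℚ.* (asymmetric 2 ℚ.+ t)) (aFormula-shape k) (iFormula-shape k) ⟨
  ½ ℚ.* (1ℚ ℚ.+ aFormula (2 + k)) ℚ.+ ½ ℚ.* (asymmetric 2 ℚ.+ iFormula (2 + k))  ∎
  where
  open ≡-Reasoning
  K X Y : ℚ
  K = fromℤ (+ k)
  X = Ψ k
  Y = Ψ (suc k)
  K₃ : fromℤ (+ (3 + k)) ≡ 1ℚ ℚ.+ (1ℚ ℚ.+ (1ℚ ℚ.+ K))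
  K₃ = trans (fromℤ-suc (2 + k)) (cong (ℚ._+_ 1ℚ) (trans (fromℤ-suc (1 + k)) (cong (ℚ._+_ 1ℚ) (fromℤ-suc k))))
  X₃ : Ψ (3 + k) ≡ next Y (next X Y)
  X₃ = trans (Ψ-rec (suc k)) (cong (next Y) (Ψ-rec k))
  Y₃ : Ψ (4 + k) ≡ next (next X Y) (next Y (next X Y))
  Y₃ = trans (Ψ-rec (2 + k)) (cong₂ next (Ψ-rec k) X₃)

aFormula-step : ∀ k → aFormula (3 + k) ≡ ½ ℚ.* aFormula (2 + k) ℚ.+ ½ ℚ.* iFormula (2 + k)
aFormula-step k = begin
  aFormula (3 + k)
    ≡⟨ aFormula-shape (suc k) ⟩
  aShape (fromℤ (+ suc k)) X′ (Ψ (2 + k)) (½^ suc k)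
    ≡⟨ cong₂ (λ s t → aShape s X′ t (½^ suc k)) (fromℤ-suc k) (Ψ-rec k) ⟩
  aShape (1ℚ ℚ.+ K) X′ (next X X′) (½ ℚ.* ½^ k)
    ≡⟨ aShape-step K X X′ (½^ k) ⟩
  ½ ℚ.* aShape K X X′ (½^ k) ℚ.+ ½ ℚ.* iShape K X X′ (½^ k)
    ≡⟨ cong₂ (λ s t → ½ ℚ.* s ℚ.+ ½ ℚ.* t) (aFormula-shape k) (iFormula-shape k) ⟨
  ½ ℚ.* aFormula (2 + k) ℚ.+ ½ ℚ.* iFormula (2 + k)  ∎
  where
  open ≡-Reasoning
  K X X′ : ℚ
  K  = fromℤ (+ k)
  X  = Ψ k
  X′ = Ψ (suc k)

ClosedFormsAt : ℕ → Set
ClosedFormsAt n = inner n ≡ iFormula n × asymmetric n ≡ aFormula n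

closedForms-step : ∀ k → ClosedFormsAt (2 + k) → ClosedFormsAt (4 + k) → ClosedFormsAt (5 + k)
closedForms-step k (i₂ , a₂) (i₄ , a₄) =
  trans (cong₂ (λ s t → ½ ℚ.* (1ℚ ℚ.+ s) ℚ.+ ½ ℚ.* (asymmetric 2 ℚ.+ t)) a₂ i₂) (sym (iFormula-step k)) ,
  trans (cong₂ (λ s t → ½ ℚ.* s ℚ.+ ½ ℚ.* t) a₄ i₄) (sym (aFormula-step (2 + k)))

closedForms-window : ∀ k → ClosedFormsAt (2 + k) × ClosedFormsAt (3 + k) × ClosedFormsAt (4 + k)
closedForms-window zero    = (refl , refl) , (refl , refl) , (refl , refl)
closedForms-window (suc k) with c₂ , c₃ , c₄ ← closedForms-window k = c₃ , c₄ , closedForms-step k c₂ c₄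

closedForms : ∀ k → ClosedFormsAt (2 + k)
closedForms k = proj₁ (closedForms-window k)

runValue : ℕ → Bool → Bool → ℚ
runValue m true  true  = outer m
runValue m true  false = asymmetric m
runValue m false true  = asymmetric m
runValue m false false = inner m

runValue-zero : ∀ L R → runValue 0 L R ≡ 0ℚ
runValue-zero true  true  = refl
runValue-zero true  false = refl
runValue-zero false true  = refl
runValue-zero false false = refl

-- Choice a b L R: in a run of a + 1 + b empty seats with boundary napkins L and R, S may seat
-- the next diner after the first a seats of the run.
data Choice : ℕ → ℕ → Bool → Bool → Set where
  byLeftNapkin   : ∀ {b R} → Choice 0 b true R
  byRightNapkin  : ∀ {a L} → Choice a 0 L true
  thirdFromLeft  : ∀ {b} → Choice 2 b false false
  thirdFromRight : ∀ {a} → Choice a 2 false false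
  single         : Choice 0 0 false false
  pairLeft       : Choice 0 1 false false
  pairRight      : Choice 1 0 false false

innerNapkin : ℕ → Bool → Bool
innerNapkin zero    N = N
innerNapkin (suc _) _ = true

-- x, y: availability of the diner's left and right napkins; vₗ, vᵣ, v₀: the expected values
-- after he takes the left one, the right one, or none.
expectation : Bool → Bool → ℚ → ℚ → ℚ → ℚ
expectation true  true  vₗ vᵣ _  = ½ ℚ.* vₗ ℚ.+ ½ ℚ.* vᵣ
expectation true  false vₗ _  _  = vₗ
expectation false true  _  vᵣ _  = vᵣ
expectation false false _  _  v₀ = 1ℚ ℚ.+ v₀

afterSeating : ℕ → ℕ → Bool → Bool → Bool → Bool → ℚ
afterSeating a b L R x y = expectation x y
  (runValue a L false ℚ.+ runValue b y R) (runValue a L x ℚ.+ runValue b false R) (runValue a L x ℚ.+ runValue b y R)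

module _ where
  open ℚ-Solver.+-*-Solver

  private
    average-0+ : ∀ x y → ½ ℚ.* x ℚ.+ ½ ℚ.* y ≡ ½ ℚ.* (0ℚ ℚ.+ x) ℚ.+ ½ ℚ.* (0ℚ ℚ.+ y)
    average-0+ = solve 2 (λ x y → con ½ :* x :+ con ½ :* y := con ½ :* (con 0ℚ :+ x) :+ con ½ :* (con 0ℚ :+ y)) refl

    average-+0 : ∀ x y → ½ ℚ.* x ℚ.+ ½ ℚ.* y ≡ ½ ℚ.* (y ℚ.+ 0ℚ) ℚ.+ ½ ℚ.* (x ℚ.+ 0ℚ)
    average-+0 = solve 2 (λ x y → con ½ :* x :+ con ½ :* y := con ½ :* (y :+ con 0ℚ) :+ con ½ :* (x :+ con 0ℚ)) refl

    average-swap : ∀ c d x y → ½ ℚ.* (c ℚ.+ y) ℚ.+ ½ ℚ.* (d ℚ.+ x) ≡ ½ ℚ.* (x ℚ.+ d) ℚ.+ ½ ℚ.* (y ℚ.+ c)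
    average-swap = solve 4 (λ c d x y → con ½ :* (c :+ y) :+ con ½ :* (d :+ x) := con ½ :* (x :+ d) :+ con ½ :* (y :+ c)) refl

  expectation-shift : ∀ x y {P Q uₗ uᵣ u₀ vₗ vᵣ v₀} →
    vₗ ≡ P ℚ.+ (uₗ ℚ.+ Q) → vᵣ ≡ P ℚ.+ (uᵣ ℚ.+ Q) → v₀ ≡ P ℚ.+ (u₀ ℚ.+ Q) →
    expectation x y vₗ vᵣ v₀ ≡ P ℚ.+ (expectation x y uₗ uᵣ u₀ ℚ.+ Q)
  expectation-shift true  true  {P} {Q} {uₗ} {uᵣ} refl refl _ =
    solve 4 (λ P Q uₗ uᵣ → con ½ :* (P :+ (uₗ :+ Q)) :+ con ½ :* (P :+ (uᵣ :+ Q))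
                           := P :+ ((con ½ :* uₗ :+ con ½ :* uᵣ) :+ Q)) refl P Q uₗ uᵣ
  expectation-shift true  false refl _ _ = refl
  expectation-shift false true  _ refl _ = refl
  expectation-shift false false {P} {Q} {u₀ = u₀} _ _ refl =
    solve 3 (λ P Q u₀ → con 1ℚ :+ (P :+ (u₀ :+ Q)) := P :+ ((con 1ℚ :+ u₀) :+ Q)) refl P Q u₀

  runValue-choice : ∀ {a b L R} → Choice a b L R →
    runValue (suc (a + b)) L R ≡ afterSeating a b L R (innerNapkin a L) (innerNapkin b R)
  runValue-choice {b = zero}  {R = true}  byLeftNapkin  = refl
  runValue-choice {b = zero}  {R = false} byLeftNapkin  = refl
  runValue-choice {b = suc b} {R = true}  byLeftNapkin  = average-0+ (outer (suc b)) (asymmetric (suc b))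
  runValue-choice {b = suc b} {R = false} byLeftNapkin  = average-0+ (asymmetric (suc b)) (inner (suc b))
  runValue-choice {a = zero}  {L = true}  byRightNapkin = refl
  runValue-choice {a = zero}  {L = false} byRightNapkin = refl
  runValue-choice {a = suc a} {L = true}  byRightNapkin rewrite ℕ.+-identityʳ a =
    average-+0 (outer (suc a)) (asymmetric (suc a))
  runValue-choice {a = suc a} {L = false} byRightNapkin rewrite ℕ.+-identityʳ a =
    average-+0 (asymmetric (suc a)) (inner (suc a))
  runValue-choice {b = zero}  thirdFromLeft  = refl
  runValue-choice {b = suc b} thirdFromLeft  = refl
  runValue-choice {a = zero}  thirdFromRight = refl
  runValue-choice {a = suc a} thirdFromRight rewrite ℕ.+-comm a 2 =
    average-swap (inner 2) (asymmetric 2) (inner (suc a)) (asymmetric (suc a))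
  runValue-choice single    = refl
  runValue-choice pairLeft  = refl
  runValue-choice pairRight = refl

-- In scanValue m L R, m is
-- the length of the run being read, L its left boundary napkin and R the last napkin read.
-- The second clause is junk: the napkins of a well-formed row do not run out.
scanValue : ℕ → Bool → Bool → List Bool → List Bool → ℚ
scanValue m L R []           _        = runValue m L R
scanValue m L R (_ ∷ _)      []       = 0ℚ
scanValue m L R (false ∷ ss) (N ∷ ns) = scanValue (suc m) L N ss ns
scanValue m L R (true ∷ ss)  (N ∷ ns) = runValue m L R ℚ.+ scanValue 0 N N ss ns

rowValue : Row → ℚ
rowValue (row ss [])       = 0ℚ
rowValue (row ss (N ∷ ns)) = scanValue 0 N N ss ns

scanValue-split : ∀ A NA → length NA ≡ length A → ∀ m L R X N Y →
  scanValue m L R (A ++ true ∷ X) (NA ++ N ∷ Y) ≡ scanValue m L R A NA ℚ.+ scanValue 0 N N X Y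
scanValue-split []          []        _   m L R X N Y = refl
scanValue-split (false ∷ A) (M ∷ NA) len m L R X N Y =
  scanValue-split A NA (ℕ.suc-injective len) (suc m) L M X N Y
scanValue-split (true ∷ A)  (M ∷ NA) len m L R X N Y = begin
  runValue m L R ℚ.+ scanValue 0 M M (A ++ true ∷ X) (NA ++ N ∷ Y)
    ≡⟨ cong (runValue m L R ℚ.+_) (scanValue-split A NA (ℕ.suc-injective len) 0 M M X N Y) ⟩
  runValue m L R ℚ.+ (scanValue 0 M M A NA ℚ.+ scanValue 0 N N X Y)
    ≡⟨ ℚ.+-assoc (runValue m L R) (scanValue 0 M M A NA) (scanValue 0 N N X Y) ⟨
  runValue m L R ℚ.+ scanValue 0 M M A NA ℚ.+ scanValue 0 N N X Y  ∎
  where open ≡-Reasoning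

lastOr : Bool → List Bool → Bool
lastOr d []       = d
lastOr d (x ∷ xs) = lastOr x xs

scanValue-empties : ∀ Zs m L R S T →
  scanValue m L R (replicate (length Zs) false ++ S) (Zs ++ T) ≡ scanValue (m + length Zs) L (lastOr R Zs) S T
scanValue-empties []       m L R S T = cong (λ k → scanValue k L R S T) (sym (ℕ.+-identityʳ m))
scanValue-empties (z ∷ Zs) m L R S T =
  trans (scanValue-empties Zs (suc m) L z S T) (cong (λ k → scanValue k L (lastOr z Zs) S T) (sym (ℕ.+-suc m (length Zs))))

data EndsOccupied : List Bool → Set where
  empty    : EndsOccupied []
  occupied : ∀ A → EndsOccupied (A ∷ʳ true)

data StartsOccupied : List Bool → Set where
  empty    : StartsOccupied []
  occupied : ∀ B → StartsOccupied (true ∷ B)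

length-∷ʳ : ∀ (xs : List Bool) x → length (xs ∷ʳ x) ≡ suc (length xs)
length-∷ʳ xs x = trans (List.length-++ xs) (ℕ.+-comm (length xs) 1)

rowValue-prefix : ∀ {A} NA → EndsOccupied A → length NA ≡ length A →
  Σ ℚ λ v → ∀ X L Y → rowValue (row (A ++ X) (NA ++ L ∷ Y)) ≡ v ℚ.+ scanValue 0 L L X Y
rowValue-prefix []       empty          _   = 0ℚ , λ X L Y → sym (ℚ.+-identityˡ _)
rowValue-prefix []       (occupied A) len with () ← trans len (length-∷ʳ A true)
rowValue-prefix (N ∷ NA) (occupied A) len = scanValue 0 N N A NA , λ X L Y → begin
  scanValue 0 N N ((A ∷ʳ true) ++ X) (NA ++ L ∷ Y)  ≡⟨ cong (λ s → scanValue 0 N N s (NA ++ L ∷ Y)) (List.++-assoc A (true ∷ []) X) ⟩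
  scanValue 0 N N (A ++ true ∷ X) (NA ++ L ∷ Y)     ≡⟨ scanValue-split A NA (ℕ.suc-injective (trans len (length-∷ʳ A true))) 0 N N X L Y ⟩
  scanValue 0 N N A NA ℚ.+ scanValue 0 L L X Y        ∎
  where open ≡-Reasoning

scanValue-suffix : ∀ {B} NB → StartsOccupied B → length NB ≡ length B →
  Σ ℚ λ v → ∀ m L R → scanValue m L R B NB ≡ runValue m L R ℚ.+ v
scanValue-suffix NB       empty        _ = 0ℚ , λ m L R → sym (ℚ.+-identityʳ _)
scanValue-suffix (N ∷ NB) (occupied B) _ = scanValue 0 N N B NB , λ m L R → refl

-- The seats A, then a empty seats, the seat c, b empty seats, then B; and their napkins NA,
-- then L left of the run, Ls after each of its first a seats, y after c, Rs after each of the
-- b remaining seats (so lastOr y Rs is the right boundary napkin of the run), then NB.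
seatsAround : List Bool → ℕ → Bool → ℕ → List Bool → List Bool
seatsAround A a c b B = A ++ replicate a false ++ c ∷ replicate b false ++ B

napsAround : List Bool → Bool → List Bool → Bool → List Bool → List Bool → List Bool
napsAround NA L Ls y Rs NB = NA ++ L ∷ Ls ++ y ∷ Rs ++ NB

module _ {A B NA NB : List Bool} (ends : EndsOccupied A) (starts : StartsOccupied B)
         (lenA : length NA ≡ length A) (lenB : length NB ≡ length B) where

  prefixValue suffixValue : ℚ
  prefixValue = proj₁ (rowValue-prefix NA ends lenA)
  suffixValue = proj₁ (scanValue-suffix NB starts lenB)

  rowValue-aroundEmpty : ∀ L Ls y Rs →
    rowValue (row (seatsAround A (length Ls) false (length Rs) B) (napsAround NA L Ls y Rs NB))
      ≡ prefixValue ℚ.+ (runValue (suc (length Ls + length Rs)) L (lastOr y Rs) ℚ.+ suffixValue)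
  rowValue-aroundEmpty L Ls y Rs = begin
    rowValue (row (seatsAround A a false b B) (napsAround NA L Ls y Rs NB))
      ≡⟨ proj₂ (rowValue-prefix NA ends lenA) _ L _ ⟩
    prefixValue ℚ.+ scanValue 0 L L (replicate a false ++ false ∷ replicate b false ++ B) (Ls ++ y ∷ Rs ++ NB)
      ≡⟨ cong (prefixValue ℚ.+_) (scanValue-empties Ls 0 L L _ _) ⟩
    prefixValue ℚ.+ scanValue (suc a) L y (replicate b false ++ B) (Rs ++ NB)
      ≡⟨ cong (prefixValue ℚ.+_) (scanValue-empties Rs (suc a) L y B NB) ⟩
    prefixValue ℚ.+ scanValue (suc (a + b)) L (lastOr y Rs) B NB
      ≡⟨ cong (prefixValue ℚ.+_) (proj₂ (scanValue-suffix NB starts lenB) _ L _) ⟩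
    prefixValue ℚ.+ (runValue (suc (a + b)) L (lastOr y Rs) ℚ.+ suffixValue)  ∎
    where
    open ≡-Reasoning
    a b : ℕ
    a = length Ls
    b = length Rs

  rowValue-aroundOccupied : ∀ L Ls y Rs →
    rowValue (row (seatsAround A (length Ls) true (length Rs) B) (napsAround NA L Ls y Rs NB))
      ≡ prefixValue ℚ.+ ((runValue (length Ls) L (lastOr L Ls) ℚ.+ runValue (length Rs) y (lastOr y Rs)) ℚ.+ suffixValue)
  rowValue-aroundOccupied L Ls y Rs = begin
    rowValue (row (seatsAround A a true b B) (napsAround NA L Ls y Rs NB))
      ≡⟨ proj₂ (rowValue-prefix NA ends lenA) _ L _ ⟩
    prefixValue ℚ.+ scanValue 0 L L (replicate a false ++ true ∷ replicate b false ++ B) (Ls ++ y ∷ Rs ++ NB)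
      ≡⟨ cong (prefixValue ℚ.+_) (scanValue-empties Ls 0 L L _ _) ⟩
    prefixValue ℚ.+ (runValue a L (lastOr L Ls) ℚ.+ scanValue 0 y y (replicate b false ++ B) (Rs ++ NB))
      ≡⟨ cong (λ t → prefixValue ℚ.+ (runValue a L (lastOr L Ls) ℚ.+ t)) (scanValue-empties Rs 0 y y B NB) ⟩
    prefixValue ℚ.+ (runValue a L (lastOr L Ls) ℚ.+ scanValue b y (lastOr y Rs) B NB)
      ≡⟨ cong (λ t → prefixValue ℚ.+ (runValue a L (lastOr L Ls) ℚ.+ t)) (proj₂ (scanValue-suffix NB starts lenB) _ y _) ⟩
    prefixValue ℚ.+ (runValue a L (lastOr L Ls) ℚ.+ (runValue b y (lastOr y Rs) ℚ.+ suffixValue))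
      ≡⟨ cong (prefixValue ℚ.+_) (ℚ.+-assoc (runValue a L (lastOr L Ls)) (runValue b y (lastOr y Rs)) suffixValue) ⟨
    prefixValue ℚ.+ ((runValue a L (lastOr L Ls) ℚ.+ runValue b y (lastOr y Rs)) ℚ.+ suffixValue)  ∎
    where
    open ≡-Reasoning
    a b : ℕ
    a = length Ls
    b = length Rs

record WellFormed (r : Row) : Set where
  field
    napkinCount  : length (naps r) ≡ suc (length (seats r))
    betweenEmpty : ∀ k → Emp r k → Emp r (suc k) → Avail r k
open WellFormed public

‼-++ : ∀ xs ys k → (xs ++ ys) ‼ (length xs + k) ≡ ys ‼ k
‼-++ []       ys k = refl
‼-++ (x ∷ xs) ys k = ‼-++ xs ys k

‼-++-length : ∀ xs ys → (xs ++ ys) ‼ length xs ≡ ys ‼ 0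
‼-++-length []       ys = refl
‼-++-length (x ∷ xs) ys = ‼-++-length xs ys

replicate-++-‼ : ∀ k x ys t → t < k → (replicate k x ++ ys) ‼ t ≡ just x
replicate-++-‼ (suc k) x ys zero    _         = refl
replicate-++-‼ (suc k) x ys (suc t) (s≤s t<k) = replicate-++-‼ k x ys t t<k

lastOr-‼ : ∀ L Ls rest → ((L ∷ Ls) ++ rest) ‼ length Ls ≡ just (lastOr L Ls)
lastOr-‼ L []       rest = refl
lastOr-‼ L (t ∷ Ls) rest = lastOr-‼ t Ls rest

replicate-join : ∀ a b (x : Bool) B → replicate a x ++ x ∷ replicate b x ++ B ≡ replicate (a + suc b) x ++ B
replicate-join zero    b x B = refl
replicate-join (suc a) b x B = cong (x ∷_) (replicate-join a b x B)

EndsOccupied-‼ : ∀ {A} M → EndsOccupied A → (true ∷ ((A ++ M) ++ true ∷ [])) ‼ length A ≡ just true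
EndsOccupied-‼ M empty        = refl
EndsOccupied-‼ M (occupied A) rewrite length-∷ʳ A true = begin
  (((A ∷ʳ true) ++ M) ∷ʳ true) ‼ length A   ≡⟨ cong (λ s → (s ∷ʳ true) ‼ length A) (List.++-assoc A (true ∷ []) M) ⟩
  ((A ++ true ∷ M) ∷ʳ true) ‼ length A      ≡⟨ cong (_‼ length A) (List.++-assoc A (true ∷ M) (true ∷ [])) ⟩
  (A ++ true ∷ M ∷ʳ true) ‼ length A        ≡⟨ ‼-++-length A _ ⟩
  just true                               ∎
  where open ≡-Reasoning

StartsOccupied-‼ : ∀ {B} → StartsOccupied B → (B ∷ʳ true) ‼ 0 ≡ just true
StartsOccupied-‼ empty        = refl
StartsOccupied-‼ (occupied B) = refl

module Around {A B NA NB : List Bool} (ends : EndsOccupied A) (starts : StartsOccupied B)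
              (lenA : length NA ≡ length A) (L : Bool) (Ls : List Bool) (y : Bool) (Rs : List Bool) where

  a b N : ℕ
  a = length Ls
  b = length Rs
  N = length A

  r : Row
  r = row (seatsAround A a false b B) (napsAround NA L Ls y Rs NB)

  private
    ext-run : ext r ≡ true ∷ (A ++ replicate (a + suc b) false ++ B ∷ʳ true)
    ext-run = cong (true ∷_) (begin
      (A ++ replicate a false ++ false ∷ replicate b false ++ B) ∷ʳ true
        ≡⟨ List.++-assoc A _ (true ∷ []) ⟩
      A ++ (replicate a false ++ false ∷ replicate b false ++ B) ∷ʳ true
        ≡⟨ cong (A ++_) (List.++-assoc (replicate a false) _ (true ∷ [])) ⟩
      A ++ replicate a false ++ false ∷ (replicate b false ++ B) ∷ʳ true
        ≡⟨ cong (λ t → A ++ replicate a false ++ false ∷ t) (List.++-assoc (replicate b false) B (true ∷ [])) ⟩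
      A ++ replicate a false ++ false ∷ replicate b false ++ B ∷ʳ true
        ≡⟨ cong (A ++_) (replicate-join a b false (B ∷ʳ true)) ⟩
      A ++ replicate (a + suc b) false ++ B ∷ʳ true  ∎)
      where open ≡-Reasoning

  occupiedBefore : Occ r N
  occupiedBefore = EndsOccupied-‼ _ ends

  emptyAt : ∀ t → t < a + suc b → Emp r (suc (N + t))
  emptyAt t t<run = begin
    ext r ‼ suc (N + t)                                            ≡⟨ cong (_‼ suc (N + t)) ext-run ⟩
    (A ++ replicate (a + suc b) false ++ B ∷ʳ true) ‼ (N + t)       ≡⟨ ‼-++ A _ t ⟩
    (replicate (a + suc b) false ++ B ∷ʳ true) ‼ t                 ≡⟨ replicate-++-‼ (a + suc b) false _ t t<run ⟩
    just false                                                     ∎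
    where open ≡-Reasoning

  occupiedAfter : Occ r (suc (N + (a + suc b)))
  occupiedAfter = begin
    ext r ‼ suc (N + (a + suc b))                                          ≡⟨ cong (_‼ suc (N + (a + suc b))) ext-run ⟩
    (A ++ replicate (a + suc b) false ++ B ∷ʳ true) ‼ (N + (a + suc b))    ≡⟨ ‼-++ A _ (a + suc b) ⟩
    (replicate (a + suc b) false ++ B ∷ʳ true) ‼ (a + suc b)              ≡⟨ cong (λ k → (replicate (a + suc b) false ++ B ∷ʳ true) ‼ k) (List.length-replicate (a + suc b)) ⟨
    (replicate (a + suc b) false ++ B ∷ʳ true) ‼ length (replicate (a + suc b) false)
                                                                           ≡⟨ ‼-++-length (replicate (a + suc b) false) _ ⟩
    (B ∷ʳ true) ‼ 0                                                        ≡⟨ StartsOccupied-‼ starts ⟩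
    just true                                                              ∎
    where open ≡-Reasoning

  private
    naps-‼ : ∀ k → naps r ‼ (N + k) ≡ (L ∷ Ls ++ y ∷ Rs ++ NB) ‼ k
    naps-‼ k = subst (λ l → naps r ‼ (l + k) ≡ (L ∷ Ls ++ y ∷ Rs ++ NB) ‼ k) lenA (‼-++ NA _ k)

  napkinBefore : naps r ‼ N ≡ just L
  napkinBefore = trans (cong (naps r ‼_) (sym (ℕ.+-identityʳ N))) (naps-‼ 0)

  napkinLeftOf : naps r ‼ (N + a) ≡ just (lastOr L Ls)
  napkinLeftOf = trans (naps-‼ a) (lastOr-‼ L Ls (y ∷ Rs ++ NB))

  napkinRightOf : naps r ‼ suc (N + a) ≡ just y
  napkinRightOf = trans (cong (naps r ‼_) (sym (ℕ.+-suc N a))) (trans (naps-‼ (suc a)) (‼-++-length Ls (y ∷ Rs ++ NB)))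

  napkinAfter : naps r ‼ suc (N + (a + b)) ≡ just (lastOr y Rs)
  napkinAfter = trans (cong (naps r ‼_) (sym (ℕ.+-suc N (a + b))))
    (trans (naps-‼ (suc (a + b))) (trans (‼-++ Ls _ b) (lastOr-‼ y Rs NB)))

∷ʳ-‼ : ∀ xs i → (xs ∷ʳ true) ‼ i ≡ just false → xs ‼ i ≡ just false
∷ʳ-‼ []       zero    ()
∷ʳ-‼ []       (suc i) ()
∷ʳ-‼ (x ∷ xs) zero    e = e
∷ʳ-‼ (x ∷ xs) (suc i) e = ∷ʳ-‼ xs i e

split-‼ : ∀ xs i {c} → xs ‼ i ≡ just c → Σ (List Bool) λ X → Σ (List Bool) λ Y → xs ≡ X ++ c ∷ Y × length X ≡ i
split-‼ (x ∷ xs) zero    refl = [] , xs , refl , refl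
split-‼ (x ∷ xs) (suc i) e with X , Y , refl , refl ← split-‼ xs i e = x ∷ X , Y , refl , refl

data TrailingEmpties : List Bool → Set where
  trailing : ∀ {A} → EndsOccupied A → ∀ a → TrailingEmpties (A ++ replicate a false)

trailingEmpties : ∀ X → TrailingEmpties X
trailingEmpties [] = trailing empty 0
trailingEmpties (x ∷ X) with trailingEmpties X
trailingEmpties (false ∷ .(replicate a false)) | trailing empty a = trailing empty (suc a)
trailingEmpties (true  ∷ .(replicate a false)) | trailing empty a = trailing (occupied []) a
trailingEmpties (x ∷ .((A ∷ʳ true) ++ replicate a false)) | trailing (occupied A) a = trailing (occupied (x ∷ A)) a

data LeadingEmpties : List Bool → Set where
  leading : ∀ b {B} → StartsOccupied B → LeadingEmpties (replicate b false ++ B)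

leadingEmpties : ∀ Y → LeadingEmpties Y
leadingEmpties []          = leading 0 empty
leadingEmpties (true ∷ Y)  = leading 0 (occupied Y)
leadingEmpties (false ∷ Y) with leadingEmpties Y
... | leading b starts = leading (suc b) starts

splitAt-length : ∀ (xs : List Bool) k j → length xs ≡ k + j →
  Σ (List Bool) λ X → Σ (List Bool) λ Y → xs ≡ X ++ Y × length X ≡ k × length Y ≡ j
splitAt-length xs       zero    j len = [] , xs , refl , refl , len
splitAt-length (x ∷ xs) (suc k) j len with X , Y , refl , refl , refl ← splitAt-length xs k j (ℕ.suc-injective len) =
  x ∷ X , Y , refl , refl , refl

uncons-length : ∀ (xs : List Bool) j → length xs ≡ suc j → Σ Bool λ x → Σ (List Bool) λ Y → xs ≡ x ∷ Y × length Y ≡ j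
uncons-length (x ∷ xs) j len = x , xs , refl , ℕ.suc-injective len

length-seatsAround : ∀ A a c b B → length (seatsAround A a c b B) ≡ length A + (a + suc (b + length B))
length-seatsAround A a c b B = begin
  length (A ++ replicate a false ++ c ∷ replicate b false ++ B)              ≡⟨ List.length-++ A ⟩
  length A + length (replicate a false ++ c ∷ replicate b false ++ B)        ≡⟨ cong (_+_ (length A)) (List.length-++ (replicate a false)) ⟩
  length A + (length (replicate a false) + suc (length (replicate b false ++ B)))
    ≡⟨ cong (λ t → length A + (length (replicate a false) + suc t)) (List.length-++ (replicate b false)) ⟩
  length A + (length (replicate a false) + suc (length (replicate b false) + length B))
    ≡⟨ cong₂ (λ s t → length A + (s + suc (t + length B))) (List.length-replicate a) (List.length-replicate b) ⟩
  length A + (a + suc (b + length B))                                        ∎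
  where open ≡-Reasoning

napkinCount-around : ∀ (ns : List Bool) A a b B →
  length ns ≡ suc (length ((A ++ replicate a false) ++ false ∷ replicate b false ++ B)) →
  length ns ≡ length A + suc (a + suc (b + length B))
napkinCount-around ns A a b B count = begin
  length ns                                                        ≡⟨ count ⟩
  suc (length ((A ++ replicate a false) ++ false ∷ replicate b false ++ B))
    ≡⟨ cong (λ s → suc (length s)) (List.++-assoc A (replicate a false) _) ⟩
  suc (length (seatsAround A a false b B))                         ≡⟨ cong suc (length-seatsAround A a false b B) ⟩
  suc (length A + (a + suc (b + length B)))                        ≡⟨ ℕ.+-suc (length A) _ ⟨
  length A + suc (a + suc (b + length B))                          ∎
  where open ≡-Reasoning

record Decomposition (r : Row) (p : ℕ) : Set where
  constructor decomposition
  field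
    {A B NA NB} : List Bool
    ends   : EndsOccupied A
    starts : StartsOccupied B
    lenA   : length NA ≡ length A
    lenB   : length NB ≡ length B
    L      : Bool
    Ls     : List Bool
    y      : Bool
    Rs     : List Bool
    row-eq : r ≡ Around.r {NA = NA} {NB = NB} ends starts lenA L Ls y Rs
    pos-eq : p ≡ suc (length A + length Ls)

decompose : ∀ r p → length (naps r) ≡ suc (length (seats r)) → Emp r p → Decomposition r p
decompose (row ss ns) (suc i) count emp
  with X , Y , refl , refl ← split-‼ ss i (∷ʳ-‼ ss i emp)
  with trailingEmpties X | leadingEmpties Y
... | trailing {A} ends a | leading b {B} starts
  with NA , R₁ , refl , lenA , len₁ ← splitAt-length ns (length A) _ (napkinCount-around ns A a b B count)
  with L , R₂ , refl , len₂ ← uncons-length R₁ _ len₁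
  with Ls , R₃ , refl , refl , len₃ ← splitAt-length R₂ a _ len₂
  with y , R₄ , refl , len₄ ← uncons-length R₃ _ len₃
  with Rs , NB , refl , refl , lenB ← splitAt-length R₄ b (length B) len₄ =
  decomposition {NA = NA} {NB = NB} ends starts lenA lenB L Ls y Rs
    (cong (λ s → row s (napsAround NA L Ls y Rs NB)) (List.++-assoc A _ _))
    (cong suc (trans (List.length-++ A) (cong (_+_ (length A)) (List.length-replicate (length Ls)))))

occupied≢empty : ∀ r {i j} → Occ r i → Emp r j → i ≢ j
occupied≢empty r occ emp refl with () ← trans (sym occ) emp

private
  before-offset₂ : ∀ q N → q + 3 ≡ suc (N + 0) → N ≡ q + 2
  before-offset₂ q N eq = sym (trans (ℕ.suc-injective (trans (sym (ℕ.+-suc q 2)) eq)) (ℕ.+-identityʳ N))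

  before-offset₁ : ∀ q N → q + 3 ≡ suc (N + 1) → N ≡ q + 1
  before-offset₁ q N eq = sym (ℕ.suc-injective (begin
    suc (q + 1)  ≡⟨ ℕ.+-suc q 1 ⟨
    q + 2        ≡⟨ ℕ.suc-injective (trans (sym (ℕ.+-suc q 2)) eq) ⟩
    N + 1        ≡⟨ ℕ.+-comm N 1 ⟩
    suc N        ∎))
    where open ≡-Reasoning

  shift₃ : ∀ N l → suc (N + suc (suc (suc l))) ≡ suc (N + l) + 3
  shift₃ = solve-∀

  shift-after : ∀ N a k → suc (N + a) + suc k ≡ suc (N + (a + suc k))
  shift-after = solve-∀

short-choice : ∀ a b → a + suc b < 3 → Choice a b false false
short-choice 0 0 _ = single
short-choice 0 1 _ = pairLeft
short-choice 1 0 _ = pairRight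
short-choice 0 (suc (suc b)) (s≤s (s≤s (s≤s ())))
short-choice 1 (suc b) (s≤s (s≤s (s≤s ())))
short-choice (suc (suc a)) b (s≤s (s≤s (s≤s lt))) with () ← ℕ.≤-trans (ℕ.m≤n+m (suc b) a) lt

module _ {A B NA NB : List Bool} (ends : EndsOccupied A) (starts : StartsOccupied B)
         (lenA : length NA ≡ length A) where

  private
    module At = Around {NA = NA} {NB = NB} ends starts lenA

  S1Seat-choice : ∀ L Ls y Rs → let open At L Ls y Rs in
    S1Seat r (suc (N + a)) → Choice a b L (lastOr y Rs)
  S1Seat-choice L Ls y [] (_ , k , avail , inj₁ (refl , _))
    with refl ← just-injective (trans (sym (At.napkinRightOf L Ls y [])) avail) = byRightNapkin
  S1Seat-choice L Ls y (w ∷ Rs) (_ , k , _ , inj₁ (refl , occ)) =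
    ⊥-elim (occupied≢empty r occ (emptyAt (suc a) (subst (suc a <_) (sym (ℕ.+-suc a b)) (s≤s (ℕ.m<m+n a (s≤s z≤n)))))
                                 (cong suc (sym (ℕ.+-suc N a))))
    where open At L Ls y (w ∷ Rs)
  S1Seat-choice L [] y Rs (_ , k , avail , inj₂ (p≡1+k , _))
    with refl ← just-injective (trans (sym (At.napkinBefore L [] y Rs))
                  (subst (Avail (At.r L [] y Rs)) (trans (ℕ.suc-injective (sym p≡1+k)) (ℕ.+-identityʳ _)) avail)) =
    byLeftNapkin
  S1Seat-choice L (t ∷ Ls) y Rs (_ , k , _ , inj₂ (p≡1+k , occ)) =
    ⊥-elim (occupied≢empty r occ (emptyAt (length Ls) (s≤s (ℕ.m≤m+n (length Ls) (suc b))))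
                                 (trans (ℕ.suc-injective (sym p≡1+k)) (ℕ.+-suc N (length Ls))))
    where open At L (t ∷ Ls) y Rs

  noS1Seat-boundaries : ∀ L Ls y Rs → let open At L Ls y Rs in
    ¬ Σ ℕ (S1Seat r) → L ≡ false × lastOr y Rs ≡ false
  noS1Seat-boundaries L Ls y Rs ¬s1 = ¬-not leftS1 , ¬-not rightS1
    where
    open At L Ls y Rs
    leftS1 : L ≢ true
    leftS1 refl = ¬s1 (suc N , subst (Emp r) (cong suc (ℕ.+-identityʳ N)) (emptyAt 0 (ℕ.<-≤-trans (s≤s z≤n) (ℕ.m≤n+m (suc b) a))) ,
                       N , napkinBefore , inj₂ (refl , occupiedBefore))
    rightS1 : lastOr y Rs ≢ true
    rightS1 R≡true = ¬s1 (suc (N + (a + b)) , emptyAt (a + b) (ℕ.+-monoʳ-< a (ℕ.n<1+n b)) ,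
                          suc (N + (a + b)) , trans napkinAfter (cong just R≡true) ,
                          inj₁ (refl , subst (Occ r) (cong suc (trans (cong (_+_ N) (ℕ.+-suc a b)) (ℕ.+-suc N (a + b))))
                                                     occupiedAfter))

  S2Seat-choice : ∀ L Ls y Rs → let open At L Ls y Rs in
    S2Seat r (suc (N + a)) → Choice a b false false
  S2Seat-choice L (_ ∷ _ ∷ []) y Rs _ = thirdFromLeft
  S2Seat-choice L Ls y (_ ∷ _ ∷ []) _ = thirdFromRight
  S2Seat-choice L [] y Rs (_ , q , _ , inj₁ (eq , _ , emp₂)) =
    ⊥-elim (occupied≢empty r occupiedBefore emp₂ (before-offset₂ q N eq))
    where open At L [] y Rs
  S2Seat-choice L (t ∷ []) y Rs (_ , q , _ , inj₁ (eq , emp₁ , _)) =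
    ⊥-elim (occupied≢empty r occupiedBefore emp₁ (before-offset₁ q N eq))
    where open At L (t ∷ []) y Rs
  S2Seat-choice L (t₁ ∷ t₂ ∷ t₃ ∷ Ls) y Rs (_ , q , occ , inj₁ (eq , _ , _)) =
    ⊥-elim (occupied≢empty r occ (emptyAt (length Ls) (ℕ.≤-trans (s≤s (ℕ.m≤n+m (length Ls) 2)) (ℕ.m≤m+n a (suc b))))
                                 (ℕ.+-cancelʳ-≡ 3 q (suc (N + length Ls)) (trans eq (shift₃ N (length Ls)))))
    where open At L (t₁ ∷ t₂ ∷ t₃ ∷ Ls) y Rs
  S2Seat-choice L Ls y [] (_ , _ , _ , inj₂ (_ , emp₁ , _)) =
    ⊥-elim (occupied≢empty r occupiedAfter emp₁ (sym (shift-after N a 0)))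
    where open At L Ls y []
  S2Seat-choice L Ls y (w ∷ []) (_ , _ , _ , inj₂ (_ , _ , emp₂)) =
    ⊥-elim (occupied≢empty r occupiedAfter emp₂ (sym (shift-after N a 1)))
    where open At L Ls y (w ∷ [])
  S2Seat-choice L Ls y (w₁ ∷ w₂ ∷ w₃ ∷ Rs) (_ , _ , occ , inj₂ (refl , _ , _)) =
    ⊥-elim (occupied≢empty r occ (emptyAt (a + 3) (ℕ.+-monoʳ-< a (s≤s (s≤s (s≤s (s≤s z≤n)))))) (shift-after N a 2))
    where open At L Ls y (w₁ ∷ w₂ ∷ w₃ ∷ Rs)

  thirdSeat-S2Seat : ∀ L Ls y Rs → let open At L Ls y Rs in
    3 ≤ a + suc b → S2Seat r (suc (N + 2))
  thirdSeat-S2Seat L Ls y Rs long = emptyAt 2 long , N , occupiedBefore ,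
    inj₁ (ℕ.+-suc N 2 , subst (Emp r) (sym (ℕ.+-suc N 0)) (emptyAt 0 (ℕ.<-≤-trans (s≤s z≤n) long)) ,
                        subst (Emp r) (sym (ℕ.+-suc N 1)) (emptyAt 1 (ℕ.<-≤-trans (s≤s (s≤s z≤n)) long)))
    where open At L Ls y Rs

  private
    boundariesTaken : ∀ {L Ls y Rs} → let open At L Ls y Rs in
      ¬ Σ ℕ (S1Seat r) → Choice a b false false → Choice a b L (lastOr y Rs)
    boundariesTaken {L} {Ls} {y} {Rs} ¬s1 with refl , R≡false ← noS1Seat-boundaries L Ls y Rs ¬s1 =
      subst (Choice _ _ false) (sym R≡false)

  allowed-choice : ∀ L Ls y Rs → let open At L Ls y Rs in
    Allowed r (suc (N + a)) → Choice a b L (lastOr y Rs)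
  allowed-choice L Ls y Rs (inj₁ s1)                      = S1Seat-choice L Ls y Rs s1
  allowed-choice L Ls y Rs (inj₂ (inj₁ (¬s1 , s2)))        = boundariesTaken ¬s1 (S2Seat-choice L Ls y Rs s2)
  allowed-choice L Ls y Rs (inj₂ (inj₂ (¬s1 , ¬s2 , _))) =
    boundariesTaken ¬s1 (short-choice a b (ℕ.≰⇒> λ long → ¬s2 (_ , thirdSeat-S2Seat L Ls y Rs long)))
    where open At L Ls y Rs

seatingValue : Row → ℕ → Bool → Bool → ℚ
seatingValue r p x y = expectation x y
  (rowValue (seatTake r p (p ∸ 1))) (rowValue (seatTake r p p)) (rowValue (seatNone r p))

record OneStep (r : Row) (p : ℕ) : Set where
  constructor oneStep
  field
    {leftNapkin rightNapkin} : Bool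
    leftNapkin-at  : naps r ‼ (p ∸ 1) ≡ just leftNapkin
    rightNapkin-at : naps r ‼ p ≡ just rightNapkin
    rowValue-eq    : rowValue r ≡ seatingValue r p leftNapkin rightNapkin

set-++ : ∀ xs ys k (c : Bool) → set (xs ++ ys) (length xs + k) c ≡ xs ++ set ys k c
set-++ []       ys k c = refl
set-++ (x ∷ xs) ys k c = cong (x ∷_) (set-++ xs ys k c)

set-length : ∀ xs (z : Bool) ys c → set (xs ++ z ∷ ys) (length xs) c ≡ xs ++ c ∷ ys
set-length []       z ys c = refl
set-length (x ∷ xs) z ys c = cong (x ∷_) (set-length xs z ys c)

set-last : ∀ L Ls rest → Σ Bool λ L′ → Σ (List Bool) λ Ls′ →
  set (L ∷ Ls ++ rest) (length Ls) false ≡ L′ ∷ Ls′ ++ rest ×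
  length Ls′ ≡ length Ls × lastOr L′ Ls′ ≡ false × (Ls ≡ [] ⊎ L′ ≡ L)
set-last L []       rest = false , [] , refl , refl , refl , inj₁ refl
set-last L (t ∷ Ls) rest with L′ , Ls′ , eq , len , last , _ ← set-last t Ls rest =
  L , L′ ∷ Ls′ , cong (L ∷_) eq , cong suc len , last , inj₂ refl

runValue-lastOr : ∀ T y y′ → runValue (length T) y′ (lastOr y′ T) ≡ runValue (length T) y′ (lastOr y T)
runValue-lastOr []      y y′ = trans (runValue-zero y′ y′) (sym (runValue-zero y′ y))
runValue-lastOr (t ∷ T) y y′ = refl

runValue-leftBoundary : ∀ (Ls : List Bool) L L′ → Ls ≡ [] ⊎ L′ ≡ L → runValue (length Ls) L′ false ≡ runValue (length Ls) L false
runValue-leftBoundary .[] L L′ (inj₁ refl) = trans (runValue-zero L′ false) (sym (runValue-zero L false))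
runValue-leftBoundary Ls  L .L (inj₂ refl) = refl

seatsAround-set : ∀ A a b B → set (seatsAround A a false b B) (length A + a) true ≡ seatsAround A a true b B
seatsAround-set A a b B = trans (set-++ A _ a true) (cong (A ++_)
  (subst (λ k → set (replicate a false ++ false ∷ rest) k true ≡ replicate a false ++ true ∷ rest)
         (List.length-replicate a) (set-length (replicate a false) false rest true)))
  where
  rest : List Bool
  rest = replicate b false ++ B

module _ {A B NA NB : List Bool} (ends : EndsOccupied A) (starts : StartsOccupied B)
         (lenA : length NA ≡ length A) (lenB : length NB ≡ length B) where

  private
    module At = Around {NA = NA} {NB = NB} ends starts lenA
    P Q : ℚ
    P = prefixValue {NA = NA} {NB = NB} ends starts lenA lenB
    Q = suffixValue {NA = NA} {NB = NB} ends starts lenA lenB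

  napsAround-set : ∀ k L Ls y Rs →
    set (napsAround NA L Ls y Rs NB) (length A + k) false ≡ NA ++ set (L ∷ Ls ++ y ∷ Rs ++ NB) k false
  napsAround-set k L Ls y Rs =
    subst (λ l → set (napsAround NA L Ls y Rs NB) (l + k) false ≡ NA ++ set (L ∷ Ls ++ y ∷ Rs ++ NB) k false)
          lenA (set-++ NA _ k false)

  leftNapkin-inner : ∀ L Ls y Rs → let open At L Ls y Rs in WellFormed r → lastOr L Ls ≡ innerNapkin a L
  leftNapkin-inner L []      y Rs _  = refl
  leftNapkin-inner L (t ∷ T) y Rs wf = just-injective (trans (sym napkinLeftOf)
    (betweenEmpty wf (N + a) (subst (Emp r) (sym (ℕ.+-suc N (length T))) (emptyAt (length T) (s≤s (ℕ.m≤m+n (length T) (suc b)))))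
                             (emptyAt a (ℕ.m<m+n a (s≤s z≤n)))))
    where open At L (t ∷ T) y Rs

  rightNapkin-inner : ∀ L Ls y Rs → let open At L Ls y Rs in WellFormed r → y ≡ innerNapkin b (lastOr y Rs)
  rightNapkin-inner L Ls y []      _  = refl
  rightNapkin-inner L Ls y (w ∷ W) wf = just-injective (trans (sym napkinRightOf)
    (betweenEmpty wf (suc (N + a)) (emptyAt a (ℕ.m<m+n a (s≤s z≤n)))
      (subst (Emp r) (cong suc (ℕ.+-suc N a)) (emptyAt (suc a) (subst (suc a ℕ.<_) (sym (ℕ.+-suc a b)) (s≤s (ℕ.m<m+n a (s≤s z≤n))))))))
    where open At L Ls y (w ∷ W)

  rowValue-takeLeft : ∀ L Ls y Rs → let open At L Ls y Rs in
    rowValue (seatTake r (suc (N + a)) (N + a)) ≡ P ℚ.+ ((runValue a L false ℚ.+ runValue b y (lastOr y Rs)) ℚ.+ Q)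
  rowValue-takeLeft L Ls y Rs
    with L′ , Ls′ , napsEq , len , last , cleared ← set-last L Ls (y ∷ Rs ++ NB) = begin
    rowValue (row (set (seatsAround A a false b B) (N + a) true) (set (napsAround NA L Ls y Rs NB) (N + a) false))
      ≡⟨ cong₂ (λ s n → rowValue (row s n)) (trans (seatsAround-set A a b B) (cong (λ k → seatsAround A k true b B) (sym len)))
                                             (trans (napsAround-set a L Ls y Rs) (cong (NA ++_) napsEq)) ⟩
    rowValue (row (seatsAround A (length Ls′) true b B) (napsAround NA L′ Ls′ y Rs NB))
      ≡⟨ rowValue-aroundOccupied {NA = NA} {NB = NB} ends starts lenA lenB L′ Ls′ y Rs ⟩
    P ℚ.+ ((runValue (length Ls′) L′ (lastOr L′ Ls′) ℚ.+ runValue b y (lastOr y Rs)) ℚ.+ Q)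
      ≡⟨ cong (λ v → P ℚ.+ ((v ℚ.+ runValue b y (lastOr y Rs)) ℚ.+ Q))
              (trans (cong (runValue (length Ls′) L′) last) (trans (cong (λ k → runValue k L′ false) len) (runValue-leftBoundary Ls L L′ cleared))) ⟩
    P ℚ.+ ((runValue a L false ℚ.+ runValue b y (lastOr y Rs)) ℚ.+ Q)  ∎
    where
    open ≡-Reasoning
    open At L Ls y Rs

  rowValue-takeRight : ∀ L Ls y Rs → let open At L Ls y Rs in
    rowValue (seatTake r (suc (N + a)) (suc (N + a))) ≡ P ℚ.+ ((runValue a L (lastOr L Ls) ℚ.+ runValue b false (lastOr y Rs)) ℚ.+ Q)
  rowValue-takeRight L Ls y Rs = begin
    rowValue (row (set (seatsAround A a false b B) (N + a) true) (set (napsAround NA L Ls y Rs NB) (suc (N + a)) false))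
      ≡⟨ cong₂ (λ s n → rowValue (row s n)) (seatsAround-set A a b B)
               (trans (cong (λ k → set (napsAround NA L Ls y Rs NB) k false) (sym (ℕ.+-suc N a)))
               (trans (napsAround-set (suc a) L Ls y Rs) (cong (λ t → NA ++ L ∷ t) (set-length Ls y (Rs ++ NB) false)))) ⟩
    rowValue (row (seatsAround A a true b B) (napsAround NA L Ls false Rs NB))
      ≡⟨ rowValue-aroundOccupied {NA = NA} {NB = NB} ends starts lenA lenB L Ls false Rs ⟩
    P ℚ.+ ((runValue a L (lastOr L Ls) ℚ.+ runValue b false (lastOr false Rs)) ℚ.+ Q)
      ≡⟨ cong (λ v → P ℚ.+ ((runValue a L (lastOr L Ls) ℚ.+ v) ℚ.+ Q)) (runValue-lastOr Rs y false) ⟩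
    P ℚ.+ ((runValue a L (lastOr L Ls) ℚ.+ runValue b false (lastOr y Rs)) ℚ.+ Q)  ∎
    where
    open ≡-Reasoning
    open At L Ls y Rs

  rowValue-takeNone : ∀ L Ls y Rs → let open At L Ls y Rs in
    rowValue (seatNone r (suc (N + a))) ≡ P ℚ.+ ((runValue a L (lastOr L Ls) ℚ.+ runValue b y (lastOr y Rs)) ℚ.+ Q)
  rowValue-takeNone L Ls y Rs =
    trans (cong (λ s → rowValue (row s (napsAround NA L Ls y Rs NB))) (seatsAround-set A (length Ls) (length Rs) B))
          (rowValue-aroundOccupied {NA = NA} {NB = NB} ends starts lenA lenB L Ls y Rs)

  oneStep-around : ∀ L Ls y Rs → let open At L Ls y Rs in
    WellFormed r → Allowed r (suc (N + a)) → OneStep r (suc (N + a))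
  oneStep-around L Ls y Rs wf allowed = oneStep napkinLeftOf napkinRightOf (begin
    rowValue r
      ≡⟨ rowValue-aroundEmpty {NA = NA} {NB = NB} ends starts lenA lenB L Ls y Rs ⟩
    P ℚ.+ (runValue (suc (a + b)) L R ℚ.+ Q)
      ≡⟨ cong (λ v → P ℚ.+ (v ℚ.+ Q)) (runValue-choice (allowed-choice {NA = NA} {NB = NB} ends starts lenA L Ls y Rs allowed)) ⟩
    P ℚ.+ (afterSeating a b L R (innerNapkin a L) (innerNapkin b R) ℚ.+ Q)
      ≡⟨ cong₂ (λ x y → P ℚ.+ (afterSeating a b L R x y ℚ.+ Q)) (leftNapkin-inner L Ls y Rs wf) (rightNapkin-inner L Ls y Rs wf) ⟨
    P ℚ.+ (afterSeating a b L R (lastOr L Ls) y ℚ.+ Q)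
      ≡⟨ expectation-shift (lastOr L Ls) y {P} {Q} (rowValue-takeLeft L Ls y Rs) (rowValue-takeRight L Ls y Rs) (rowValue-takeNone L Ls y Rs) ⟨
    seatingValue r (suc (N + a)) (lastOr L Ls) y  ∎)
    where
    open ≡-Reasoning
    open At L Ls y Rs
    R : Bool
    R = lastOr y Rs

Allowed⇒Emp : ∀ {r p} → Allowed r p → Emp r p
Allowed⇒Emp (inj₁ (emp , _))               = emp
Allowed⇒Emp (inj₂ (inj₁ (_ , emp , _)))    = emp
Allowed⇒Emp (inj₂ (inj₂ (_ , _ , emp)))    = emp

rowValue-step : ∀ {r p} → WellFormed r → Allowed r p → OneStep r p
rowValue-step {r} {p} wf allowed
  with decomposition ends starts lenA lenB L Ls y Rs refl refl ← decompose r p (napkinCount wf) (Allowed⇒Emp {r} allowed) =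
  oneStep-around ends starts lenA lenB L Ls y Rs wf allowed

length-set : ∀ xs k (c : Bool) → length (set xs k c) ≡ length xs
length-set []       k       c = refl
length-set (x ∷ xs) zero    c = refl
length-set (x ∷ xs) (suc k) c = cong suc (length-set xs k c)

set-‼-≢ : ∀ xs {k j} (c : Bool) → j ≢ k → set xs k c ‼ j ≡ xs ‼ j
set-‼-≢ []       c j≢k = refl
set-‼-≢ (x ∷ xs) {zero}  {zero}  c j≢k = ⊥-elim (j≢k refl)
set-‼-≢ (x ∷ xs) {zero}  {suc j} c _   = refl
set-‼-≢ (x ∷ xs) {suc k} {zero}  c _   = refl
set-‼-≢ (x ∷ xs) {suc k} {suc j} c j≢k = set-‼-≢ xs c (j≢k ∘ cong suc)

set-∷ʳ-‼ : ∀ xs i j → (set xs i true ∷ʳ true) ‼ j ≡ just false → (xs ∷ʳ true) ‼ j ≡ just false × j ≢ i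
set-∷ʳ-‼ []       i       zero    ()
set-∷ʳ-‼ []       i       (suc j) ()
set-∷ʳ-‼ (x ∷ xs) zero    zero    ()
set-∷ʳ-‼ (x ∷ xs) zero    (suc j) emp = emp , λ ()
set-∷ʳ-‼ (x ∷ xs) (suc i) zero    emp = emp , λ ()
set-∷ʳ-‼ (x ∷ xs) (suc i) (suc j) emp with emp′ , j≢i ← set-∷ʳ-‼ xs i j emp = emp′ , j≢i ∘ ℕ.suc-injective

emptyAfterSeating : ∀ r p j → Emp r p → Emp (row (set (seats r) (p ∸ 1) true) (naps r)) j → Emp r j × j ≢ p
emptyAfterSeating r (suc i) (suc j) _ emp with emp′ , j≢i ← set-∷ʳ-‼ (seats r) i j emp = emp′ , j≢i ∘ ℕ.suc-injective

private
  napkin-untouched : ∀ {p k j} → k ≡ p ∸ 1 ⊎ k ≡ p → j ≢ p → suc j ≢ p → j ≢ k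
  napkin-untouched {p}     (inj₂ refl) j≢p _     refl = j≢p refl
  napkin-untouched {zero}  (inj₁ refl) j≢p _     refl = j≢p refl
  napkin-untouched {suc p} (inj₁ refl) _   1+j≢p refl = 1+j≢p refl

WellFormed-seatTake : ∀ {r p k} → WellFormed r → Emp r p → k ≡ p ∸ 1 ⊎ k ≡ p → WellFormed (seatTake r p k)
WellFormed-seatTake {r} {p} {k} wf emp k-adjacent = record
  { napkinCount  = trans (length-set (naps r) k false)
                         (trans (napkinCount wf) (cong suc (sym (length-set (seats r) (p ∸ 1) true))))
  ; betweenEmpty = λ j emp₁ emp₂ →
      let emp₁′ , j≢p = emptyAfterSeating r p j emp emp₁
          emp₂′ , 1+j≢p = emptyAfterSeating r p (suc j) emp emp₂
      in trans (set-‼-≢ (naps r) false (napkin-untouched k-adjacent j≢p 1+j≢p)) (betweenEmpty wf j emp₁′ emp₂′)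
  }

WellFormed-seatNone : ∀ {r p} → WellFormed r → Emp r p → WellFormed (seatNone r p)
WellFormed-seatNone {r} {p} wf emp = record
  { napkinCount  = trans (napkinCount wf) (cong suc (sym (length-set (seats r) (p ∸ 1) true)))
  ; betweenEmpty = λ j emp₁ emp₂ →
      betweenEmpty wf j (proj₁ (emptyAfterSeating r p j emp emp₁)) (proj₁ (emptyAfterSeating r p (suc j) emp emp₂))
  }

emptyCount : List Bool → ℕ
emptyCount []           = 0
emptyCount (false ∷ xs) = suc (emptyCount xs)
emptyCount (true  ∷ xs) = emptyCount xs

emptyCount-set : ∀ xs i → xs ‼ i ≡ just false → emptyCount xs ≡ suc (emptyCount (set xs i true))
emptyCount-set (false ∷ xs) zero    _   = refl
emptyCount-set (false ∷ xs) (suc i) emp = cong suc (emptyCount-set xs i emp)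
emptyCount-set (true  ∷ xs) (suc i) emp = emptyCount-set xs i emp

emptyCount-zero : ∀ xs → emptyCount xs ≡ 0 → All (_≡ true) xs
emptyCount-zero []          _     = []
emptyCount-zero (true ∷ xs) count = refl ∷ emptyCount-zero xs count

emptyCount-suc : ∀ xs {n} → emptyCount xs ≡ suc n → Σ ℕ λ i → xs ‼ i ≡ just false
emptyCount-suc (false ∷ xs) _ = 0 , refl
emptyCount-suc (true  ∷ xs) count with i , emp ← emptyCount-suc xs count = suc i , emp

‼-++ˡ : ∀ xs ys i {c} → xs ‼ i ≡ just c → (xs ++ ys) ‼ i ≡ just c
‼-++ˡ (x ∷ xs) ys zero    e = e
‼-++ˡ (x ∷ xs) ys (suc i) e = ‼-++ˡ xs ys i e

‼-bound : ∀ xs i {c} → xs ‼ i ≡ just c → i < length xs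
‼-bound (x ∷ xs) zero    _ = s≤s z≤n
‼-bound (x ∷ xs) (suc i) e = s≤s (‼-bound xs i e)

scanValue-full : ∀ ss ns L → All (_≡ true) ss → scanValue 0 L L ss ns ≡ 0ℚ
scanValue-full []          ns       L []          = runValue-zero L L
scanValue-full (true ∷ ss) []       L (refl ∷ _)  = refl
scanValue-full (true ∷ ss) (N ∷ ns) L (refl ∷ full) = cong₂ ℚ._+_ (runValue-zero L L) (scanValue-full ss ns N full)

rowValue-full : ∀ r → All (_≡ true) (seats r) → rowValue r ≡ 0ℚ
rowValue-full (row ss [])       _    = refl
rowValue-full (row ss (N ∷ ns)) full = scanValue-full ss ns N full

infix 4 _≟ᴹ_
_≟ᴹ_ : DecidableEquality (Maybe Bool)
_≟ᴹ_ = Maybe.≡-dec Bool._≟_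

Occ? : ∀ r → Decidable (Occ r)
Emp? : ∀ r → Decidable (Emp r)
Avail? : ∀ r → Decidable (Avail r)
Occ?   r p = ext r ‼ p ≟ᴹ just true
Emp?   r p = ext r ‼ p ≟ᴹ just false
Avail? r k = naps r ‼ k ≟ᴹ just true

∃-bounded? : ∀ {P : ℕ → Set} → Decidable P → ∀ v → (∀ {n} → P n → n < v) → Dec (Σ ℕ P)
∃-bounded? P? v bound = map′ (λ (n , _ , pn) → n , pn) (λ (n , pn) → n , bound pn , pn) (ℕ.anyUpTo? P? v)

S1Seat? : ∀ r p → Dec (S1Seat r p)
S1Seat? r p = Emp? r p ×-dec ∃-bounded? napkin? (suc p) bound
  where
  NapkinBeside : ℕ → Set
  NapkinBeside k = Avail r k × ((p ≡ k × Occ r (suc k)) ⊎ (p ≡ suc k × Occ r k))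
  napkin? : Decidable NapkinBeside
  napkin? k = Avail? r k ×-dec ((p ℕ.≟ k ×-dec Occ? r (suc k)) ⊎-dec (p ℕ.≟ suc k ×-dec Occ? r k))
  bound : ∀ {k} → NapkinBeside k → k < suc p
  bound (_ , inj₁ (refl , _)) = ℕ.n<1+n p
  bound (_ , inj₂ (refl , _)) = ℕ.m<n⇒m<1+n (ℕ.n<1+n _)

S2Seat? : ∀ r p → Dec (S2Seat r p)
S2Seat? r p = Emp? r p ×-dec ∃-bounded? occupied? (suc (p + 3)) bound
  where
  OccupiedThreeAway : ℕ → Set
  OccupiedThreeAway q = Occ r q ×
    ((q + 3 ≡ p × Emp r (q + 1) × Emp r (q + 2)) ⊎ (p + 3 ≡ q × Emp r (p + 1) × Emp r (p + 2)))
  occupied? : Decidable OccupiedThreeAway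
  occupied? q = Occ? r q ×-dec
    ((q + 3 ℕ.≟ p ×-dec Emp? r (q + 1) ×-dec Emp? r (q + 2)) ⊎-dec
     (p + 3 ℕ.≟ q ×-dec Emp? r (p + 1) ×-dec Emp? r (p + 2)))
  bound : ∀ {q} → OccupiedThreeAway q → q < suc (p + 3)
  bound {q} (_ , inj₁ (q+3≡p , _)) = s≤s (ℕ.≤-trans (ℕ.m≤m+n q 3) (ℕ.≤-trans (ℕ.≤-reflexive q+3≡p) (ℕ.m≤m+n p 3)))
  bound     (_ , inj₂ (refl , _))  = ℕ.n<1+n (p + 3)

allowedSeat : ∀ r {p} → Emp r p → Σ ℕ (Allowed r)
allowedSeat r {p} emp with ∃-bounded? (S1Seat? r) (length (ext r)) (λ s1 → ‼-bound (ext r) _ (proj₁ s1))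
... | yes (p₁ , s1) = p₁ , inj₁ s1
... | no ¬s1 with ∃-bounded? (S2Seat? r) (length (ext r)) (λ s2 → ‼-bound (ext r) _ (proj₁ s2))
...   | yes (p₂ , s2) = p₂ , inj₂ (inj₁ (¬s1 , s2))
...   | no ¬s2        = p , inj₂ (inj₂ (¬s1 , ¬s2 , emp))

Emp⇒seat : ∀ r {p} → Emp r p → seats r ‼ (p ∸ 1) ≡ just false
Emp⇒seat r {suc i} emp = ∷ʳ-‼ (seats r) i emp

Val-oneStep : ∀ {r p} → Allowed r p → OneStep r p →
  (∀ {k} → k ≡ p ∸ 1 ⊎ k ≡ p → Val (seatTake r p k) (rowValue (seatTake r p k))) →
  Val (seatNone r p) (rowValue (seatNone r p)) → Val r (rowValue r)
Val-oneStep {r} a (oneStep {true}  {true}  atₗ atᵣ eq) valTake _    =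
  subst (Val r) (sym eq) (both a atₗ atᵣ (valTake (inj₁ refl)) (valTake (inj₂ refl)))
Val-oneStep {r} a (oneStep {true}  {false} atₗ atᵣ eq) valTake _    =
  subst (Val r) (sym eq) (left a atₗ atᵣ (valTake (inj₁ refl)))
Val-oneStep {r} a (oneStep {false} {true}  atₗ atᵣ eq) valTake _    =
  subst (Val r) (sym eq) (right a atₗ atᵣ (valTake (inj₂ refl)))
Val-oneStep {r} a (oneStep {false} {false} atₗ atᵣ eq) _       val₀ =
  subst (Val r) (sym eq) (none a atₗ atᵣ val₀)

rowValue-Val : ∀ n r → emptyCount (seats r) ≡ n → WellFormed r → Val r (rowValue r)
rowValue-Val zero r count _ = subst (Val r) (sym (rowValue-full r full)) (done full)
  where
  full : All (_≡ true) (seats r)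
  full = emptyCount-zero (seats r) count
rowValue-Val (suc n) r count wf
  with i , emp ← emptyCount-suc (seats r) count
  with p , a ← allowedSeat r {suc i} (‼-++ˡ (seats r) (true ∷ []) i emp) =
  Val-oneStep a (rowValue-step wf a)
    (λ adj → rowValue-Val n _ count′ (WellFormed-seatTake {r} {p} wf empₚ adj))
    (rowValue-Val n _ count′ (WellFormed-seatNone {r} {p} wf empₚ))
  where
  empₚ : Emp r p
  empₚ = Allowed⇒Emp {r} {p} a
  count′ : emptyCount (set (seats r) (p ∸ 1) true) ≡ n
  count′ = ℕ.suc-injective (trans (sym (emptyCount-set (seats r) (p ∸ 1) (Emp⇒seat r {p} empₚ))) count)

expectation-rowValue : ∀ {r p x y vₗ vᵣ v₀} → WellFormed r → Allowed r p →
  naps r ‼ (p ∸ 1) ≡ just x → naps r ‼ p ≡ just y →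
  vₗ ≡ rowValue (seatTake r p (p ∸ 1)) → vᵣ ≡ rowValue (seatTake r p p) → v₀ ≡ rowValue (seatNone r p) →
  expectation x y vₗ vᵣ v₀ ≡ rowValue r
expectation-rowValue wf a atₗ atᵣ refl refl refl
  with oneStep atₗ′ atᵣ′ eq ← rowValue-step wf a
  with refl ← just-injective (trans (sym atₗ′) atₗ) | refl ← just-injective (trans (sym atᵣ′) atᵣ) = sym eq

Val-unique : ∀ {r v} → WellFormed r → Val r v → v ≡ rowValue r
Val-unique {r} wf (done full) = sym (rowValue-full r full)
Val-unique {r} wf (both {p = p} a avₗ avᵣ V W) =
  expectation-rowValue wf a avₗ avᵣ (Val-unique (WellFormed-seatTake {r} {p} wf (Allowed⇒Emp {r} a) (inj₁ refl)) V)
                                    (Val-unique (WellFormed-seatTake {r} {p} wf (Allowed⇒Emp {r} a) (inj₂ refl)) W) refl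
Val-unique {r} wf (left {p = p} a avₗ tkᵣ V) =
  expectation-rowValue wf a avₗ tkᵣ (Val-unique (WellFormed-seatTake {r} {p} wf (Allowed⇒Emp {r} a) (inj₁ refl)) V) refl refl
Val-unique {r} wf (right {p = p} a tkₗ avᵣ V) =
  expectation-rowValue wf a tkₗ avᵣ refl (Val-unique (WellFormed-seatTake {r} {p} wf (Allowed⇒Emp {r} a) (inj₂ refl)) V) refl
Val-unique {r} wf (none {p = p} a tkₗ tkᵣ V) =
  expectation-rowValue wf a tkₗ tkᵣ refl refl (Val-unique (WellFormed-seatNone {r} {p} wf (Allowed⇒Emp {r} a)) V)

scanValue-initRow : ∀ m k L R b →
  scanValue k L R (replicate (suc m) false) (replicate m true ++ b ∷ []) ≡ runValue (k + suc m) L b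
scanValue-initRow zero    k L R b = cong (λ n → runValue n L b) (ℕ.+-comm 1 k)
scanValue-initRow (suc m) k L R b =
  trans (scanValue-initRow m (suc k) L true b) (cong (λ n → runValue n L b) (sym (ℕ.+-suc k (suc m))))

rowValue-initRow : ∀ m l b → rowValue (initRow (suc m) l b) ≡ runValue (suc m) l b
rowValue-initRow m l b = scanValue-initRow m 0 l l b

WellFormed-initRow : ∀ m l b → WellFormed (initRow (suc m) l b)
WellFormed-initRow m l b = record
  { napkinCount  = cong suc (trans (length-∷ʳ (replicate m true) b)
                                   (trans (cong suc (List.length-replicate m)) (sym (List.length-replicate (suc m)))))
  ; betweenEmpty = between
  }
  where
  between : ∀ k → Emp (initRow (suc m) l b) k → Emp (initRow (suc m) l b) (suc k) → Avail (initRow (suc m) l b) k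
  between (suc k) _ emp = replicate-++-‼ m true (b ∷ []) k (ℕ.≤-pred
    (subst (suc k <_) (List.length-replicate (suc m)) (‼-bound (replicate (suc m) false) (suc k) (∷ʳ-‼ (replicate (suc m) false) (suc k) emp))))

initRow-expected : ∀ m l b → ExpectedNapkinless (initRow (suc m) l b) (runValue (suc m) l b)
initRow-expected m l b =
  subst (Val r) (rowValue-initRow m l b) (rowValue-Val _ r refl wf) ,
  λ v V → trans (Val-unique wf V) (rowValue-initRow m l b)
  where
  r : Row
  r = initRow (suc m) l b
  wf : WellFormed r
  wf = WellFormed-initRow m l b

lemma3p5 : (n : ℕ) → 2 ≤ n →
  ExpectedNapkinless (initRow n false false) (iFormula n) ×
  ((l b : Bool) → l xor b ≡ true →
    ExpectedNapkinless (initRow n l b) (aFormula n))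
lemma3p5 (suc zero)    (s≤s ())
lemma3p5 (suc (suc k)) _ =
  subst (ExpectedNapkinless _) inner≡ (initRow-expected (suc k) false false) , asymmetricRows
  where
  inner≡ : inner (2 + k) ≡ iFormula (2 + k)
  inner≡ = proj₁ (closedForms k)
  asymmetric≡ : asymmetric (2 + k) ≡ aFormula (2 + k)
  asymmetric≡ = proj₂ (closedForms k)
  asymmetricRows : (l b : Bool) → l xor b ≡ true → ExpectedNapkinless (initRow (2 + k) l b) (aFormula (2 + k))
  asymmetricRows true  false _ = subst (ExpectedNapkinless _) asymmetric≡ (initRow-expected (suc k) true false)
  asymmetricRows false true  _ = subst (ExpectedNapkinless _) asymmetric≡ (initRow-expected (suc k) false true)
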